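{- Let $H$ be the set of harmonic numbers and $P=\{p \text{ prime} : p\equiv 41 \pmod{48}\}$. Then the $abc$-conjecture is true on $H\cup P$: for every $\varepsilon>0$ there are only finitely many triples $(a,b,c)$ of coprime positive integers with $a,b,c\in H\cup P$, $a+b=c$ and $c>\operatorname{rad}(abc)^{1+\varepsilon}$.
   Context: A harmonic number is a positive integer of the form $2^a3^b$ with $a,b\ge 0$ integers (so $1$ is harmonic). For a positive integer $n$, $\operatorname{rad}(n)$ is the product of the distinct primes dividing $n$. Positive integers $a,b,c$ are coprime if they have no common prime factor.
   Formalization: The parameter ε ranges over the positive rationals. -}

module Defs where

open import Data.Nat using (ℕ; suc; _*_; _^_; _%_)
open import Data.Nat.Divisibility using (_∣_; _∣?_)
open import Data.Nat.Primality using (Prime; prime?)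
open import Data.List using (List; filter; upTo)
open import Data.Nat.ListAction using (product)
open import Data.Product using (Σ; ∃; _×_)
open import Data.Sum using (_⊎_)
open import Data.Empty using (⊥)
open import Relation.Nullary.Decidable using (_×-dec_)
open import Relation.Binary.PropositionalEquality using (_≡_)

Harmonic : ℕ → Set
Harmonic n = ∃ λ a → ∃ λ b → n ≡ 2 ^ a * 3 ^ b

InP : ℕ → Set
InP p = Prime p × p % 48 ≡ 41

InHP : ℕ → Set
InHP n = Harmonic n ⊎ InP n

-- rad n = product of the distinct primes dividing n
-- (every prime divisor of n ≥ 1 lies in [0, n]; rad 0 = 1 is never used)
rad : ℕ → ℕ
rad n = product (filter (λ p → prime? p ×-dec p ∣? n) (upTo (suc n)))

Coprime3 : ℕ → ℕ → ℕ → Set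
Coprime3 a b c = ∀ p → Prime p → p ∣ a → p ∣ b → p ∣ c → ⊥

module Submission where

-- We show that every coprime triple a + b = c in H ∪ P with c > rad(abc)^(1+ε)
-- satisfies c ≤ 9, so the triples below 10 form the required finite list.
--   * If c is prime, then c ≤ rad(abc), so c cannot exceed rad(abc)^(1+ε).
--   * If a, b, c are all harmonic, coprimality leaves only 1 + 1 = 2 and the
--     Catalan-type equations 2^i + 1 = 3^j and 3^j + 1 = 2^i, whose solutions
--     are small (a computation of residues modulo 80 and 16).
--   * Equations p + q = h and p + h₁ = h₂ with p, q ∈ P and h, h₁, h₂ ∈ H have
--     no solutions: the residues of P modulo 3, 4 and 16 rule out all cases but
--     p = 3^(2k) − 2^(2h), where the factorisation (3^k − 2^h)(3^k + 2^h) and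
--     primality force 3^k = 2^h + 1, so that p = 3^k + 2^h ≤ 18 by the
--     Catalan case.

open import Defs
open import Data.Nat using (ℕ; zero; suc; _+_; _*_; _^_; _∸_; _%_; _/_; _≤_; _<_; _≟_; _≤?_; _<?_; s≤s; z<s; NonZero; >-nonZero; nonTrivial⇒n>1)
open import Data.Nat.Properties
open import Data.Nat.DivMod using (%-distribˡ-+; %-distribˡ-*; m∣n⇒o%n%m≡o%m; m≡m%n+[m/n]*n; m%n<n; m%n≤m)
open import Data.Nat.Divisibility using (_∣_; _∣?_; divides; ∣m+n∣m⇒∣n; ∣m∣n⇒∣m+n; ∣m⇒∣m*n; ∣n⇒∣m*n; *-pres-∣; m∣m*n; n∣m*n; n∣m⇒m%n≡0; ∣⇒≤)
open import Data.Nat.Primality using (Prime; prime?; prime⇒irreducible; prime⇒nonZero; prime⇒nonTrivial)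
open import Data.Nat.ListAction.Properties using (∈⇒≤product)
open import Data.Nat.Tactic.RingSolver using (solve-∀)
open import Data.List using (List; []; _∷_; map; upTo; cartesianProduct; cartesianProductWith)
open import Data.List.Membership.Propositional using (_∈_)
open import Data.List.Membership.Propositional.Properties using (∈-map⁺; ∈-filter⁺; ∈-filter⁻; ∈-upTo⁺; ∈-cartesianProduct⁺; ∈-cartesianProductWith⁺)
open import Data.List.Relation.Unary.Any using (here; there)
open import Data.List.Relation.Unary.All as All using (All; all?)
open import Data.Product using (Σ; ∃; _×_; _,_; proj₁; proj₂)
open import Data.Sum using (_⊎_; inj₁; inj₂)
open import Data.Empty using (⊥; ⊥-elim)
open import Relation.Nullary using (¬_; yes; no; ¬?)
open import Relation.Nullary.Decidable using (Dec; True; toWitness; _×-dec_)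
open import Relation.Binary.PropositionalEquality using (_≡_; _≢_; refl; sym; trans; cong; subst; module ≡-Reasoning)

open ≡-Reasoning

mod-sum-∈ : ∀ m .{{_ : NonZero m}} x y {xs ys} → x % m ∈ xs → y % m ∈ ys →
            (x + y) % m ∈ cartesianProductWith (λ r s → (r + s) % m) xs ys
mod-sum-∈ m x y hx hy =
  subst (_∈ _) (sym (%-distribˡ-+ x y m)) (∈-cartesianProductWith⁺ (λ r s → (r + s) % m) hx hy)

mod-product-∈ : ∀ m .{{_ : NonZero m}} x y {xs ys} → x % m ∈ xs → y % m ∈ ys →
                (x * y) % m ∈ cartesianProductWith (λ r s → (r * s) % m) xs ys
mod-product-∈ m x y hx hy =
  subst (_∈ _) (sym (%-distribˡ-* x y m)) (∈-cartesianProductWith⁺ (λ r s → (r * s) % m) hx hy)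

known : ∀ {r s : ℕ} → r ≡ s → r ∈ s ∷ []
known = here

divisible⇒∈0 : ∀ {m x} .{{_ : NonZero m}} → m ∣ x → x % m ∈ 0 ∷ []
divisible⇒∈0 {m} {x} m∣x = known (n∣m⇒m%n≡0 x m m∣x)

Disjoint : List ℕ → List ℕ → Set
Disjoint xs ys = All (λ r → All (r ≢_) ys) xs

disjoint? : ∀ xs ys → Dec (Disjoint xs ys)
disjoint? xs ys = all? (λ r → all? (λ s → ¬? (r ≟ s)) ys) xs

residues-differ : ∀ m .{{_ : NonZero m}} {x y xs ys} → x % m ∈ xs → y % m ∈ ys →
                  {_ : True (disjoint? xs ys)} → x ≢ y
residues-differ m hx hy {disjoint} x≡y =
  All.lookup (All.lookup (toWitness disjoint) hx) hy (cong (_% m) x≡y)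

pow-mod-shift : ∀ a m .{{_ : NonZero m}} i j k → a ^ i % m ≡ a ^ j % m →
                a ^ (i + k) % m ≡ a ^ (j + k) % m
pow-mod-shift a m i j k same = begin
  a ^ (i + k) % m                   ≡⟨ cong (_% m) (^-distribˡ-+-* a i k) ⟩
  (a ^ i * a ^ k) % m               ≡⟨ %-distribˡ-* (a ^ i) (a ^ k) m ⟩
  (a ^ i % m * (a ^ k % m)) % m     ≡⟨ cong (λ r → (r * (a ^ k % m)) % m) same ⟩
  (a ^ j % m * (a ^ k % m)) % m     ≡⟨ %-distribˡ-* (a ^ j) (a ^ k) m ⟨
  (a ^ j * a ^ k) % m               ≡⟨ cong (_% m) (^-distribˡ-+-* a j k) ⟨
  a ^ (j + k) % m                   ∎

pow-mod-periodic : ∀ a m .{{_ : NonZero m}} s n → a ^ (n + s) % m ≡ a ^ s % m →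
                   ∀ q r → a ^ (s + (q * n + r)) % m ≡ a ^ (s + r) % m
pow-mod-periodic a m s n period zero    r = refl
pow-mod-periodic a m s n period (suc q) r = begin
  a ^ (s + ((n + q * n) + r)) % m  ≡⟨ cong (λ e → a ^ e % m) (regroup s n (q * n) r) ⟩
  a ^ ((n + s) + (q * n + r)) % m  ≡⟨ pow-mod-shift a m (n + s) s (q * n + r) period ⟩
  a ^ (s + (q * n + r)) % m        ≡⟨ pow-mod-periodic a m s n period q r ⟩
  a ^ (s + r) % m                  ∎
  where
  regroup : ∀ s n x r → s + ((n + x) + r) ≡ (n + s) + (x + r)
  regroup = solve-∀

pow-mod-residues : ∀ a m .{{_ : NonZero m}} s n .{{_ : NonZero n}} → a ^ (n + s) % m ≡ a ^ s % m →
                   ∀ k → a ^ (s + k) % m ∈ map (λ r → a ^ (s + r) % m) (upTo n)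
pow-mod-residues a m s n period k =
  subst (_∈ _) (sym reduce) (∈-map⁺ (λ r → a ^ (s + r) % m) (∈-upTo⁺ (m%n<n k n)))
  where
  reduce : a ^ (s + k) % m ≡ a ^ (s + k % n) % m
  reduce = trans (cong (λ e → a ^ (s + e) % m) (trans (m≡m%n+[m/n]*n k n) (+-comm (k % n) _)))
                 (pow-mod-periodic a m s n period (k / n) (k % n))

even-exponent : ∀ a m .{{_ : NonZero m}} k → a ^ 2 % m ≡ 1 % m → a ^ k % m ≢ a % m →
                ∃ λ h → k ≡ h + h
even-exponent a m zero          order² odd = 0 , refl
even-exponent a m (suc zero)    order² odd = ⊥-elim (odd (cong (_% m) (*-identityʳ a)))
even-exponent a m (suc (suc k)) order² odd
  with even-exponent a m k order² (λ r → odd (trans (pow-mod-shift a m 2 0 k order²) r))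
... | h , refl = suc h , cong suc (sym (+-suc h h))

pow3-mod16 : ∀ j → 3 ^ j % 16 ∈ 1 ∷ 3 ∷ 9 ∷ 11 ∷ []
pow3-mod16 = pow-mod-residues 3 16 0 4 refl

pow3-mod80 : ∀ j → 3 ^ j % 80 ∈ 1 ∷ 3 ∷ 9 ∷ 27 ∷ []
pow3-mod80 = pow-mod-residues 3 80 0 4 refl

pow2-mod80 : ∀ i → 2 ^ (4 + i) % 80 ∈ 16 ∷ 32 ∷ 64 ∷ 48 ∷ []
pow2-mod80 = pow-mod-residues 2 80 4 4 refl

pow-∣ : ∀ a k n → a ^ k ∣ a ^ (k + n)
pow-∣ a k n = divides (a ^ n) (trans (^-distribˡ-+-* a k n) (*-comm (a ^ k) (a ^ n)))

pow2-mod16 : ∀ s → 2 ^ s % 16 ∈ 1 ∷ 2 ∷ 4 ∷ 8 ∷ 0 ∷ []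
pow2-mod16 0 = here refl
pow2-mod16 1 = there (here refl)
pow2-mod16 2 = there (there (here refl))
pow2-mod16 3 = there (there (there (here refl)))
pow2-mod16 (suc (suc (suc (suc s)))) = there (there (there (there (divisible⇒∈0 (pow-∣ 2 4 s)))))

harmonic : ℕ → ℕ → ℕ
harmonic x y = 2 ^ x * 3 ^ y

harmonic-pow2 : ∀ x → harmonic x 0 ≡ 2 ^ x
harmonic-pow2 x = *-identityʳ (2 ^ x)

harmonic-pow3 : ∀ y → harmonic 0 y ≡ 3 ^ y
harmonic-pow3 y = *-identityˡ (3 ^ y)

two∣harmonic : ∀ x y → 2 ∣ harmonic (suc x) y
two∣harmonic x y = ∣m⇒∣m*n (3 ^ y) (m∣m*n (2 ^ x))

three∣harmonic : ∀ x y → 3 ∣ harmonic x (suc y)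
three∣harmonic x y = ∣n⇒∣m*n (2 ^ x) (m∣m*n (3 ^ y))

sixteen∣harmonic : ∀ x y → 16 ∣ harmonic (4 + x) y
sixteen∣harmonic x y = ∣m⇒∣m*n (3 ^ y) (pow-∣ 2 4 x)

harmonic-mod16 : ∀ x y → harmonic x y % 16 ∈
                 cartesianProductWith (λ r s → (r * s) % 16) (1 ∷ 2 ∷ 4 ∷ 8 ∷ 0 ∷ []) (1 ∷ 3 ∷ 9 ∷ 11 ∷ [])
harmonic-mod16 x y = mod-product-∈ 16 (2 ^ x) (3 ^ y) (pow2-mod16 x) (pow3-mod16 y)

odd-harmonic-mod16 : ∀ y → harmonic 0 y % 16 ∈ 1 ∷ 3 ∷ 9 ∷ 11 ∷ []
odd-harmonic-mod16 y = subst (λ n → n % 16 ∈ _) (sym (harmonic-pow3 y)) (pow3-mod16 y)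

-- Catalan-type equation 2^i + 1 = 3^j: it forces 3^j ≤ 9, since for i ≥ 4
-- 2^i + 1 ∈ {17, 33, 49, 65} but 3^j ∈ {1, 3, 9, 27} modulo 80.
catalan-2-3 : ∀ i j → 2 ^ i + 1 ≡ 3 ^ j → 3 ^ j ≤ 9
catalan-2-3 0 j eq = subst (_≤ 9) eq (m≤m+n 2 7)
catalan-2-3 1 j eq = subst (_≤ 9) eq (m≤m+n 3 6)
catalan-2-3 2 j eq = subst (_≤ 9) eq (m≤m+n 5 4)
catalan-2-3 3 j eq = subst (_≤ 9) eq ≤-refl
catalan-2-3 (suc (suc (suc (suc i)))) j eq =
  ⊥-elim (residues-differ 80 (mod-sum-∈ 80 (2 ^ (4 + i)) 1 (pow2-mod80 i) (known refl)) (pow3-mod80 j) eq)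

-- 3^j + 1 = 2^i forces 2^i ≤ 8: for i ≥ 4, 3^j + 1 ∈ {2, 4, 10, 12} modulo 16.
catalan-3-2 : ∀ j i → 3 ^ j + 1 ≡ 2 ^ i → 2 ^ i ≤ 9
catalan-3-2 j 0 eq = m≤m+n 1 8
catalan-3-2 j 1 eq = m≤m+n 2 7
catalan-3-2 j 2 eq = m≤m+n 4 5
catalan-3-2 j 3 eq = m≤m+n 8 1
catalan-3-2 j (suc (suc (suc (suc i)))) eq =
  ⊥-elim (residues-differ 16 (mod-sum-∈ 16 (3 ^ j) 1 (pow3-mod16 j) (known refl)) (divisible⇒∈0 (pow-∣ 2 4 i)) eq)

harmonic-catalan-2-3 : ∀ i j → harmonic i 0 + 1 ≡ harmonic 0 j → harmonic 0 j ≤ 9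
harmonic-catalan-2-3 i j sum = subst (_≤ 9) (sym (harmonic-pow3 j))
  (catalan-2-3 i j (trans (cong (_+ 1) (sym (harmonic-pow2 i))) (trans sum (harmonic-pow3 j))))

harmonic-catalan-3-2 : ∀ j i → harmonic 0 j + 1 ≡ harmonic i 0 → harmonic i 0 ≤ 9
harmonic-catalan-3-2 j i sum = subst (_≤ 9) (sym (harmonic-pow2 i))
  (catalan-3-2 j i (trans (cong (_+ 1) (sym (harmonic-pow3 j))) (trans sum (harmonic-pow2 i))))

∣-summand : ∀ {d x y z} → x + y ≡ z → d ∣ y → d ∣ z → d ∣ x
∣-summand {d} {x} {y} sum d∣y d∣z = ∣m+n∣m⇒∣n (subst (d ∣_) (trans (sym sum) (+-comm x y)) d∣z) d∣y

no-common-prime-ab : ∀ {a b c q} → Coprime3 a b c → a + b ≡ c → Prime q → q ∣ a → q ∣ b → ⊥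
no-common-prime-ab coprime sum q-prime q∣a q∣b =
  coprime _ q-prime q∣a q∣b (subst (_ ∣_) sum (∣m∣n⇒∣m+n q∣a q∣b))

no-common-prime-ac : ∀ {a b c q} → Coprime3 a b c → a + b ≡ c → Prime q → q ∣ a → q ∣ c → ⊥
no-common-prime-ac {a} {b} coprime sum q-prime q∣a q∣c =
  coprime _ q-prime q∣a (∣-summand (trans (+-comm b a) sum) q∣a q∣c) q∣c

no-common-prime-bc : ∀ {a b c q} → Coprime3 a b c → a + b ≡ c → Prime q → q ∣ b → q ∣ c → ⊥
no-common-prime-bc {a} {b} coprime sum =
  no-common-prime-ac (λ q q-prime q∣b q∣a → coprime q q-prime q∣a q∣b) (trans (+-comm b a) sum)

prime-2 : Prime 2
prime-2 = toWitness {a? = prime? 2} _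

prime-3 : Prime 3
prime-3 = toWitness {a? = prime? 3} _

-- All-harmonic coprime sums: once no prime 2 or 3 is shared, and the sum is
-- not odd + odd = odd, only 1 + 1 = 2 and the Catalan-type equations remain.
harmonic-sum-bound : ∀ x₁ y₁ x₂ y₂ x₃ y₃ →
  Coprime3 (harmonic x₁ y₁) (harmonic x₂ y₂) (harmonic x₃ y₃) →
  harmonic x₁ y₁ + harmonic x₂ y₂ ≡ harmonic x₃ y₃ → harmonic x₃ y₃ ≤ 9
harmonic-sum-bound _ _ _ _ 0 0 _ _ = m≤m+n 1 8
harmonic-sum-bound (suc x₁) y₁ (suc x₂) y₂ x₃ y₃ coprime sum =
  ⊥-elim (no-common-prime-ab coprime sum prime-2 (two∣harmonic x₁ y₁) (two∣harmonic x₂ y₂))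
harmonic-sum-bound (suc x₁) y₁ x₂ y₂ (suc x₃) y₃ coprime sum =
  ⊥-elim (no-common-prime-ac coprime sum prime-2 (two∣harmonic x₁ y₁) (two∣harmonic x₃ y₃))
harmonic-sum-bound x₁ y₁ (suc x₂) y₂ (suc x₃) y₃ coprime sum =
  ⊥-elim (no-common-prime-bc coprime sum prime-2 (two∣harmonic x₂ y₂) (two∣harmonic x₃ y₃))
harmonic-sum-bound x₁ (suc y₁) x₂ (suc y₂) x₃ y₃ coprime sum =
  ⊥-elim (no-common-prime-ab coprime sum prime-3 (three∣harmonic x₁ y₁) (three∣harmonic x₂ y₂))
harmonic-sum-bound x₁ (suc y₁) x₂ y₂ x₃ (suc y₃) coprime sum =
  ⊥-elim (no-common-prime-ac coprime sum prime-3 (three∣harmonic x₁ y₁) (three∣harmonic x₃ y₃))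
harmonic-sum-bound x₁ y₁ x₂ (suc y₂) x₃ (suc y₃) coprime sum =
  ⊥-elim (no-common-prime-bc coprime sum prime-3 (three∣harmonic x₂ y₂) (three∣harmonic x₃ y₃))
harmonic-sum-bound 0 y₁ 0 y₂ 0 y₃ _ sum =
  ⊥-elim (residues-differ 16 (mod-sum-∈ 16 (harmonic 0 y₁) (harmonic 0 y₂)
                                (odd-harmonic-mod16 y₁) (odd-harmonic-mod16 y₂))
                             (odd-harmonic-mod16 y₃) sum)
harmonic-sum-bound 0 0 0 0 x₃ y₃ _ sum = subst (_≤ 9) sum (m≤m+n 2 7)
harmonic-sum-bound (suc x₁) 0 0 0 0 (suc y₃) _ sum = harmonic-catalan-2-3 (suc x₁) (suc y₃) sum
harmonic-sum-bound 0 0 (suc x₂) 0 0 (suc y₃) _ sum = harmonic-catalan-2-3 (suc x₂) (suc y₃) (trans (+-comm _ 1) sum)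
harmonic-sum-bound 0 (suc y₁) 0 0 (suc x₃) 0 _ sum = harmonic-catalan-3-2 (suc y₁) (suc x₃) sum
harmonic-sum-bound 0 0 0 (suc y₂) (suc x₃) 0 _ sum = harmonic-catalan-3-2 (suc y₂) (suc x₃) (trans (+-comm _ 1) sum)

P-mod : ∀ {p} d .{{_ : NonZero d}} → InP p → d ∣ 48 → p % d ≡ 41 % d
P-mod {p} d (_ , p≡41) d∣48 = trans (sym (m∣n⇒o%n%m≡o%m d 48 p d∣48)) (cong (_% d) p≡41)

P-not-small : ∀ {p} → InP p → p < 41 → ⊥
P-not-small {p} (_ , p≡41) p<41 = <-irrefl refl (<-≤-trans p<41 (subst (_≤ p) p≡41 (m%n≤m p 48)))

P-sum-not-small : ∀ {p x n} → InP p → p + x ≡ n → {_ : True (n <? 41)} → ⊥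
P-sum-not-small {p} {x} P sum {n<41} =
  P-not-small P (≤-<-trans (subst (p ≤_) sum (m≤m+n p x)) (toWitness n<41))

P-not-even : ∀ {p} → InP p → ¬ 2 ∣ p
P-not-even {p} P 2∣p = residues-differ 2 {p} {p} (known (P-mod 2 P (divides 24 refl))) (divisible⇒∈0 2∣p) refl

P-not-multiple-of-3 : ∀ {p} → InP p → ¬ 3 ∣ p
P-not-multiple-of-3 {p} P 3∣p = residues-differ 3 {p} {p} (known (P-mod 3 P (divides 16 refl))) (divisible⇒∈0 3∣p) refl

-- Two elements of P never add up to a harmonic number: p + q ≡ 1 (mod 3)
-- and p + q ≡ 2 (mod 4) force the harmonic number to be at most 2.
P-sum-not-harmonic : ∀ {p q} → InP p → InP q → ∀ s t → p + q ≡ harmonic s t → ⊥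
P-sum-not-harmonic {p} {q} P Q s (suc t) sum =
  residues-differ 3 (mod-sum-∈ 3 p q (known (P-mod 3 P (divides 16 refl))) (known (P-mod 3 Q (divides 16 refl))))
                    (divisible⇒∈0 (three∣harmonic s t)) sum
P-sum-not-harmonic {p} {q} P Q (suc (suc s)) 0 sum =
  residues-differ 4 (mod-sum-∈ 4 p q (known (P-mod 4 P (divides 12 refl))) (known (P-mod 4 Q (divides 12 refl))))
                    (divisible⇒∈0 (∣m⇒∣m*n 1 (pow-∣ 2 2 s))) sum
P-sum-not-harmonic P Q 0 0 sum = P-sum-not-small P sum
P-sum-not-harmonic P Q 1 0 sum = P-sum-not-small P sum

-- If p + y² = (y + k)² with p prime, then p = (2y + k)·k, so k = 1
-- (k = p is impossible as 2y + k > 1).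
prime-square-gap : ∀ {p y k} → Prime p → p + y * y ≡ (y + k) * (y + k) → k ≡ 1
prime-square-gap {p} {y} {k} p-prime sum = gap (prime⇒irreducible p-prime (divides w factored))
  where
  w = y + k + y
  expand : ∀ y k → (y + k) * (y + k) ≡ (y + k + y) * k + y * y
  expand = solve-∀
  factored : p ≡ w * k
  factored = +-cancelʳ-≡ (y * y) p (w * k) (trans sum (expand y k))
  gap : k ≡ 1 ⊎ k ≡ p → k ≡ 1
  gap (inj₁ k≡1) = k≡1
  gap (inj₂ k≡p) = ⊥-elim (<-irrefl (trans k≡p (trans factored (*-comm w k))) (m<m*n k w {{k≢0}} 1<w))
    where
    k≢0 = subst NonZero (sym k≡p) (prime⇒nonZero p-prime)
    1<w : 1 < w
    1<w = <-≤-trans (subst (1 <_) (sym k≡p) (nonTrivial⇒n>1 p {{prime⇒nonTrivial p-prime}}))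
                    (≤-trans (m≤n+m k y) (m≤m+n (y + k) y))

-- A prime difference of squares p = x² − y² has x = y + 1 and p = x + y
-- (x < y is impossible since then x² < y² ≤ p + y²).
prime-difference-of-squares : ∀ {p x y} → Prime p → p + y * y ≡ x * x → x ≡ suc y × p ≡ x + y
prime-difference-of-squares {p} {x} {y} p-prime sum with y ≤? x
... | no y≰x = ⊥-elim (<-irrefl refl (<-≤-trans (*-mono-< x<y x<y) (subst (y * y ≤_) sum (m≤n+m (y * y) p))))
  where
  x<y = ≰⇒> y≰x
... | yes y≤x = consecutive , +-cancelʳ-≡ (y * y) p (x + y) (begin
  p + y * y            ≡⟨ sum ⟩
  x * x                ≡⟨ cong (λ z → z * z) consecutive ⟩
  suc y * suc y        ≡⟨ expand y ⟩
  suc y + y + y * y    ≡⟨ cong (λ z → z + y + y * y) consecutive ⟨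
  x + y + y * y        ∎)
  where
  x≡y+k : x ≡ y + (x ∸ y)
  x≡y+k = sym (m+[n∸m]≡n y≤x)
  consecutive : x ≡ suc y
  consecutive = trans x≡y+k (trans (cong (y +_) (prime-square-gap {y = y} p-prime (subst (λ z → p + y * y ≡ z * z) x≡y+k sum)))
                                   (+-comm y 1))
  expand : ∀ y → suc y * suc y ≡ suc y + y + y * y
  expand = solve-∀

-- p = 3^(2k) − 2^(2h+2) with p ∈ P is impossible: by primality
-- 3^k = 2^(h+1) + 1, so 3^k ≤ 9 and p = 3^k + 2^(h+1) ≤ 18.
P-not-difference-of-squares : ∀ {p} → InP p → ∀ h k → p + 2 ^ (suc h + suc h) ≡ 3 ^ (k + k) → ⊥
P-not-difference-of-squares {p} P h k sum = P-not-small P (≤-<-trans p≤18 (m≤m+n 19 22))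
  where
  Y = 2 ^ suc h
  X = 3 ^ k
  squares : p + Y * Y ≡ X * X
  squares = begin
    p + Y * Y              ≡⟨ cong (p +_) (^-distribˡ-+-* 2 (suc h) (suc h)) ⟨
    p + 2 ^ (suc h + suc h) ≡⟨ sum ⟩
    3 ^ (k + k)            ≡⟨ ^-distribˡ-+-* 3 k k ⟩
    X * X                  ∎
  consecutive = prime-difference-of-squares (proj₁ P) squares
  X≤9 : X ≤ 9
  X≤9 = catalan-2-3 (suc h) k (trans (+-comm Y 1) (sym (proj₁ consecutive)))
  Y≤9 : Y ≤ 9
  Y≤9 = ≤-trans (subst (Y ≤_) (sym (proj₁ consecutive)) (n≤1+n Y)) X≤9
  p≤18 : p ≤ 18
  p≤18 = subst (_≤ 18) (sym (proj₂ consecutive)) (+-mono-≤ X≤9 Y≤9)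

-- p + 2^(u+1) = 3^(t+1) with p ∈ P: residues modulo 3 and 4 make both
-- exponents even, reducing to a difference of squares.
P-plus-pow2-not-pow3 : ∀ {p} → InP p → ∀ u t → p + 2 ^ suc u ≡ 3 ^ suc t → ⊥
P-plus-pow2-not-pow3 {p} P u t sum
  with even-exponent 2 3 (suc u) refl (λ odd →
         residues-differ 3 (mod-sum-∈ 3 p (2 ^ suc u) (known (P-mod 3 P (divides 16 refl))) (known odd))
                           (divisible⇒∈0 (m∣m*n (3 ^ t))) sum)
... | suc h , refl
  with even-exponent 3 4 (suc t) refl (λ odd →
         residues-differ 4 (mod-sum-∈ 4 p (2 ^ (suc h + suc h)) (known (P-mod 4 P (divides 12 refl))) (divisible⇒∈0 four∣Y²))
                           (known odd) sum)
  where
  two∣Y : 2 ∣ 2 ^ suc h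
  two∣Y = m∣m*n (2 ^ h)
  four∣Y² : 4 ∣ 2 ^ (suc h + suc h)
  four∣Y² = subst (4 ∣_) (sym (^-distribˡ-+-* 2 (suc h) (suc h))) (*-pres-∣ two∣Y two∣Y)
... | suc k , refl = P-not-difference-of-squares P h (suc k) sum

-- Since
-- p is coprime to 6, the two harmonic numbers share neither 2 nor 3; the
-- remaining cases are excluded modulo 16, by size, or reduce to p + 2^u = 3^t.
P-plus-harmonic-not-harmonic : ∀ {p} → InP p → ∀ u v s t → p + harmonic u v ≡ harmonic s t → ⊥
P-plus-harmonic-not-harmonic P (suc u) v (suc s) t sum =
  P-not-even P (∣-summand sum (two∣harmonic u v) (two∣harmonic s t))
P-plus-harmonic-not-harmonic P u (suc v) s (suc t) sum =
  P-not-multiple-of-3 P (∣-summand sum (three∣harmonic u v) (three∣harmonic s t))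
P-plus-harmonic-not-harmonic {p} P 0 0 s t sum =
  residues-differ 16 (mod-sum-∈ 16 p 1 (known (P-mod 16 P (divides 3 refl))) (known refl)) (harmonic-mod16 s t) sum
P-plus-harmonic-not-harmonic {p} P 0 v (suc (suc (suc (suc s)))) t sum =
  residues-differ 16 (mod-sum-∈ 16 p (harmonic 0 v) (known (P-mod 16 P (divides 3 refl))) (harmonic-mod16 0 v))
                     (divisible⇒∈0 (sixteen∣harmonic s t)) sum
P-plus-harmonic-not-harmonic P 0 (suc v) 0 0 sum = P-sum-not-small P sum
P-plus-harmonic-not-harmonic P 0 (suc v) 1 0 sum = P-sum-not-small P sum
P-plus-harmonic-not-harmonic P 0 (suc v) 2 0 sum = P-sum-not-small P sum
P-plus-harmonic-not-harmonic P 0 (suc v) 3 0 sum = P-sum-not-small P sum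
P-plus-harmonic-not-harmonic P (suc u) v 0 0 sum = P-sum-not-small P sum
P-plus-harmonic-not-harmonic {p} P (suc u) 0 0 (suc t) sum =
  P-plus-pow2-not-pow3 P u t (trans (cong (p +_) (sym (harmonic-pow2 (suc u)))) (trans sum (harmonic-pow3 (suc t))))

HP-sum-bound : ∀ {a b c} → Coprime3 a b c → InHP a → InHP b → Harmonic c → a + b ≡ c → c ≤ 9
HP-sum-bound coprime (inj₁ (x₁ , y₁ , refl)) (inj₁ (x₂ , y₂ , refl)) (x₃ , y₃ , refl) sum =
  harmonic-sum-bound x₁ y₁ x₂ y₂ x₃ y₃ coprime sum
HP-sum-bound _ (inj₂ P) (inj₁ (u , v , refl)) (s , t , refl) sum =
  ⊥-elim (P-plus-harmonic-not-harmonic P u v s t sum)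
HP-sum-bound {a} _ (inj₁ (u , v , refl)) (inj₂ P) (s , t , refl) sum =
  ⊥-elim (P-plus-harmonic-not-harmonic P u v s t (trans (+-comm _ a) sum))
HP-sum-bound _ (inj₂ P) (inj₂ Q) (s , t , refl) sum = ⊥-elim (P-sum-not-harmonic P Q s t sum)

prime-factor≤rad : ∀ {p n} → 0 < n → Prime p → p ∣ n → p ≤ rad n
prime-factor≤rad {p} {n} n>0 p-prime p∣n =
  ∈⇒≤product (All.tabulate (λ q∈ → prime⇒nonZero (proj₁ (proj₂ (∈-filter⁻ prime-divisor? {xs = upTo (suc n)} q∈)))))
             (∈-filter⁺ prime-divisor? (∈-upTo⁺ (s≤s (∣⇒≤ {{>-nonZero n>0}} p∣n))) (p-prime , p∣n))
  where
  prime-divisor? = λ q → prime? q ×-dec q ∣? n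

prime-not-hit : ∀ {c n} d e → 0 < n → Prime c → c ∣ n → rad n ^ (suc d + suc e) < c ^ suc d → ⊥
prime-not-hit {c} {n} d e n>0 c-prime c∣n hit =
  <⇒≱ hit (≤-trans (^-monoˡ-≤ (suc d) c≤rad) (^-monoʳ-≤ (rad n) {{rad≢0}} (m≤m+n (suc d) (suc e))))
  where
  c≤rad = prime-factor≤rad n>0 c-prime c∣n
  rad≢0 = >-nonZero (<-≤-trans (<-trans z<s (nonTrivial⇒n>1 c {{prime⇒nonTrivial c-prime}})) c≤rad)

triples-below : ℕ → List (ℕ × ℕ × ℕ)
triples-below n = cartesianProduct (upTo n) (cartesianProduct (upTo n) (upTo n))

small-sum∈triples : ∀ {a b c} → a + b ≡ c → c ≤ 9 → (a , b , c) ∈ triples-below 10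
small-sum∈triples {a} {b} sum c≤9 =
  ∈-cartesianProduct⁺ (∈-upTo⁺ (s≤s (bounded (m≤m+n a b))))
    (∈-cartesianProduct⁺ (∈-upTo⁺ (s≤s (bounded (m≤n+m b a)))) (∈-upTo⁺ (s≤s c≤9)))
  where
  bounded : ∀ {x} → x ≤ a + b → x ≤ 9
  bounded x≤a+b = ≤-trans x≤a+b (subst (_≤ 9) (sym sum) c≤9)

corollary2p5 : (e d : ℕ) →
    Σ (List (ℕ × ℕ × ℕ)) λ L →
      ∀ a b c → 0 < a → 0 < b → 0 < c → Coprime3 a b c →
        InHP a → InHP b → InHP c → a + b ≡ c →
        rad (a * b * c) ^ (suc d + suc e) < c ^ suc d →
        (a , b , c) ∈ L
corollary2p5 e d = triples-below 10 , hits-are-small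
  where
  hits-are-small : ∀ a b c → 0 < a → 0 < b → 0 < c → Coprime3 a b c →
                   InHP a → InHP b → InHP c → a + b ≡ c →
                   rad (a * b * c) ^ (suc d + suc e) < c ^ suc d →
                   (a , b , c) ∈ triples-below 10
  hits-are-small a b c a>0 b>0 c>0 _ _ _ (inj₂ (c-prime , _)) _ hit =
    ⊥-elim (prime-not-hit d e (*-mono-< (*-mono-< a>0 b>0) c>0) c-prime (n∣m*n (a * b)) hit)
  hits-are-small a b c _ _ _ coprime a∈HP b∈HP (inj₁ c∈H) sum _ =
    small-sum∈triples sum (HP-sum-bound coprime a∈HP b∈HP c∈H sum)
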